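{- Let $A$ be a permutation that does not contain a fixed point. Then for every integer $k>0$ there exist two distinct permutations $X$ and $Y$ such that $AX^k=AY^k$.
   Context: A permutation is a finite set with a bijection on it, viewed as a functional digraph (disjoint union of cycles) up to isomorphism. Product is the direct product of digraphs (vertex set $V(A)\times V(B)$, arc $(u,u')\to(v,v')$ iff $u\to v$ and $u'\to v'$), and $X^k$ is the $k$-fold product. A fixed point is a cycle of length $1$. -}

module Defs where

open import Data.Nat using (ℕ; zero; suc; _*_)
open import Data.Fin using (Fin)
open import Data.Fin.Properties using (*↔×; 1↔⊤)
open import Data.Unit using (⊤; tt)
open import Data.Product using (Σ; ∃; _×_; _,_)
open import Data.Product.Function.NonDependent.Propositional using (_×-↔_)
open import Function.Bundles using (_↔_; Inverse)
open import Function.Properties.Inverse using (↔-trans; ↔-sym; ↔-refl)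
open import Relation.Binary.PropositionalEquality using (_≡_)
open import Relation.Nullary using (¬_)

-- A (finite) permutation: a finite set (in bijection with Fin size)
-- together with a bijection on it.  Viewed as a functional digraph x → σ x.
record Perm : Set₁ where
  field
    Carrier : Set
    size    : ℕ
    enum    : Carrier ↔ Fin size
    σ       : Carrier ↔ Carrier

open Perm public

app : (A : Perm) → Carrier A → Carrier A
app A = Inverse.to (σ A)

-- isomorphism of permutations (= isomorphism of their functional digraphs)
_≅_ : Perm → Perm → Set
A ≅ B = Σ (Carrier A ↔ Carrier B) λ φ →
          ∀ x → Inverse.to φ (app A x) ≡ app B (Inverse.to φ x)

HasFixedPoint : Perm → Set
HasFixedPoint A = ∃ λ x → app A x ≡ x

-- direct product: (u,u') → (σ u, τ u'), which is the direct product of digraphs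
_⊗_ : Perm → Perm → Perm
A ⊗ B = record
  { Carrier = Carrier A × Carrier B
  ; size    = size A * size B
  ; enum    = ↔-trans (enum A ×-↔ enum B) (↔-sym *↔×)
  ; σ       = σ A ×-↔ σ B
  }

𝟙 : Perm
𝟙 = record { Carrier = ⊤ ; size = 1 ; enum = ↔-sym 1↔⊤ ; σ = ↔-refl }

_^_ : Perm → ℕ → Perm
X ^ zero  = 𝟙
X ^ suc k = X ⊗ (X ^ k)

-- Over a cycle of length q, the q fixed points D_q = Fixed q and the q-cycle
-- C_q = Cycle q become isomorphic: C_q ⊗ D_q ≅ C_q ⊗ C_q. Put X₀ = ∅, Y₀ = 1 and
--   X_{r+1} = X_r ⊗ D_{r+2} ⊕ Y_r ⊗ C_{r+2},   Y_{r+1} = Y_r ⊗ D_{r+2} ⊕ X_r ⊗ C_{r+2}.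
-- Then X_r has no fixed point while Y_r has one, yet C_ℓ ⊗ X_r ≅ C_ℓ ⊗ Y_r for
-- 2 ≤ ℓ ≤ r + 1. Indeed, over a cycle of length r + 2 one may trade D_{r+2} for C_{r+2}
-- in one summand of X_{r+1} and C_{r+2} for D_{r+2} in the other, which gives Y_{r+1}
-- up to the order of the summands; shorter cycles are handled by induction in both
-- summands. A fixed-point-free A has only cycles of length 2 … |A|, so
-- A ⊗ X_|A| ≅ A ⊗ Y_|A|, and this passes to k-th powers factor by factor.
-- To avoid decomposing A into cycles, isomorphisms over A are built fibrewise, as
-- twists: families of bijections φ_a : B ↔ C with φ_{σa} ∘ σ_B = σ_C ∘ φ_a. Over a
-- cycle of length q the fibre of C_q ⊗ D_q ≅ C_q ⊗ C_q at a is rotation by the phase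
-- of a: its position on the cycle, counted from the point of least index.

module Submission where

open import Defs
open import Data.Nat using (ℕ; _<_)
open import Data.Product using (Σ; _×_)
open import Relation.Nullary using (¬_)

open import Level using (0ℓ)
open import Data.Nat
  using ( zero; suc; pred; _+_; _*_; _∸_; _≤_; _≮_; _<?_; _≟_; z≤n; s≤s; s≤s⁻¹; z<s; s<s
        ; NonZero; >-nonZero; >-nonZero⁻¹; anyUpTo?)
open import Data.Nat.Properties
open import Data.Nat.DivMod
  using ( _%_; _/_; _mod_; m≡m%n+[m/n]*n; m%n<n; m<n⇒m%n≡m; n%n≡0; m%n%n≡m%n
        ; %-distribˡ-+; [m+n]%n≡m%n)
open import Data.Nat.GeneralisedArithmetic using (iterate)
open import Data.Nat.Induction using (<-rec)
open import Data.Fin as Fin using (Fin; toℕ)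
open import Data.Fin.Properties using (toℕ-injective; toℕ-fromℕ<; toℕ<n; pigeonhole; 0↔⊥; +↔⊎)
open import Data.Unit using (tt)
open import Data.Empty using (⊥)
open import Data.Sum using (_⊎_; inj₁; inj₂; [_,_]′)
open import Data.Sum.Properties using (inj₁-injective; inj₂-injective)
open import Data.Sum.Function.Propositional using (_⊎-↔_)
open import Data.Product using (∃; _,_; proj₁; proj₂)
open import Data.Product.Properties using (,-injectiveˡ; ,-injectiveʳ)
open import Data.Product.Function.NonDependent.Propositional using (_×-↔_)
open import Function.Base using (_∘_)
open import Function.Bundles using (_↔_; Inverse; Injection; mk↔ₛ′)
open import Function.Definitions using (Injective)
open import Function.Properties.Inverse using (↔-refl; ↔-sym; ↔-trans; ↔⇒↣)
open import Function.Related.TypeIsomorphisms using (⊎-comm)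
open import Relation.Binary.PropositionalEquality
open import Relation.Nullary using (Dec; yes; no; contradiction)
open import Relation.Nullary.Decidable using (_×-dec_; map′)
open import Relation.Unary using (Pred; Decidable; _⊆_; _∩_; ∁)

open Inverse using (to; from; strictlyInverseˡ; strictlyInverseʳ)

to-injective : ∀ {S T : Set} (φ : S ↔ T) → Injective _≡_ _≡_ (to φ)
to-injective φ = Injection.injective (↔⇒↣ φ)

Least : ∀ {p} → Pred ℕ p → Pred ℕ p
Least P m = P m × (∀ {k} → k < m → ¬ P k)

least : ∀ {p} {P : Pred ℕ p} → Decidable P → ∀ {n} → P n → ∃ (Least P)
least {P = P} P? {n} = <-rec (λ n → P n → ∃ (Least P)) step n
  where
  step : ∀ n → (∀ {m} → m < n → P m → ∃ (Least P)) → P n → ∃ (Least P)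
  step n below Pn with anyUpTo? P? n
  ... | yes (m , m<n , Pm) = below m<n Pm
  ... | no ∄ = n , Pn , λ k<n Pk → ∄ (_ , k<n , Pk)

Least⇒≤ : ∀ {p} {P : Pred ℕ p} {m n} → Least P m → P n → m ≤ n
Least⇒≤ (_ , minimal) Pn = ≮⇒≥ (λ n<m → minimal n<m Pn)

Least-unique : ∀ {p} {P Q : Pred ℕ p} {m n} → P ⊆ Q → Q ⊆ P → Least P m → Least Q n → m ≡ n
Least-unique P⊆Q Q⊆P lm ln = ≤-antisym (Least⇒≤ lm (Q⊆P (proj₁ ln))) (Least⇒≤ ln (P⊆Q (proj₁ lm)))

module _ {S : Set} (f : S → S) where

  iterate-+ : ∀ x m n → iterate f x (m + n) ≡ iterate f (iterate f x m) n
  iterate-+ x zero    n = refl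
  iterate-+ x (suc m) n = iterate-+ (f x) m n

  iterate-suc : ∀ x n → iterate f x (suc n) ≡ f (iterate f x n)
  iterate-suc x n = trans (cong (iterate f x) (+-comm 1 n)) (iterate-+ x n 1)

  iterate-injective : Injective _≡_ _≡_ f → ∀ {x y} n → iterate f x n ≡ iterate f y n → x ≡ y
  iterate-injective f-injective zero    eq = eq
  iterate-injective f-injective (suc n) eq = f-injective (iterate-injective f-injective n eq)

  iterate-∸-cancel : Injective _≡_ _≡_ f → ∀ {x i j} → i ≤ j → iterate f x i ≡ iterate f x j →
                     iterate f x (j ∸ i) ≡ x
  iterate-∸-cancel f-injective {x} {i} {j} i≤j same = iterate-injective f-injective i (begin
    iterate f (iterate f x (j ∸ i)) i ≡⟨ iterate-+ x (j ∸ i) i ⟨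
    iterate f x (j ∸ i + i)           ≡⟨ cong (iterate f x) (m∸n+n≡m i≤j) ⟩
    iterate f x j                     ≡⟨ same ⟨
    iterate f x i                     ∎)
    where open ≡-Reasoning

  module _ {x p} (x-periodic : iterate f x p ≡ x) where

    iterate-*-period : ∀ t → iterate f x (t * p) ≡ x
    iterate-*-period zero    = refl
    iterate-*-period (suc t) = begin
      iterate f x (p + t * p)            ≡⟨ iterate-+ x p (t * p) ⟩
      iterate f (iterate f x p) (t * p)  ≡⟨ cong (λ y → iterate f y (t * p)) x-periodic ⟩
      iterate f x (t * p)                ≡⟨ iterate-*-period t ⟩
      x                                  ∎
      where open ≡-Reasoning

    iterate-%-period : .{{_ : NonZero p}} → ∀ m → iterate f x m ≡ iterate f x (m % p)
    iterate-%-period m = begin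
      iterate f x m
        ≡⟨ cong (iterate f x) (trans (m≡m%n+[m/n]*n m p) (+-comm (m % p) _)) ⟩
      iterate f x (m / p * p + m % p)
        ≡⟨ iterate-+ x (m / p * p) (m % p) ⟩
      iterate f (iterate f x (m / p * p)) (m % p)
        ≡⟨ cong (λ y → iterate f y (m % p)) (iterate-*-period (m / p)) ⟩
      iterate f x (m % p)
        ∎
      where open ≡-Reasoning

    iterate-inverse : .{{_ : NonZero p}} → ∀ k → iterate f (iterate f x k) (k * pred p) ≡ x
    iterate-inverse k = begin
      iterate f (iterate f x k) (k * pred p) ≡⟨ iterate-+ x k (k * pred p) ⟨
      iterate f x (k + k * pred p)           ≡⟨ cong (iterate f x) (*-suc k (pred p)) ⟨
      iterate f x (k * suc (pred p))         ≡⟨ cong (iterate f x ∘ (k *_)) (suc-pred p) ⟩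
      iterate f x (k * p)                    ≡⟨ iterate-*-period k ⟩
      x                                      ∎
      where open ≡-Reasoning

  iterate-↔ : ∀ {p} .{{_ : NonZero p}} → (∀ x → iterate f x p ≡ x) → ℕ → S ↔ S
  iterate-↔ {p} periodic k =
    mk↔ₛ′ (λ x → iterate f x k) (λ x → iterate f x (k * pred p))
          to∘from (λ x → iterate-inverse (periodic x) k)
    where
    to∘from : ∀ x → iterate f (iterate f x (k * pred p)) k ≡ x
    to∘from x = begin
      iterate f (iterate f x (k * pred p)) k ≡⟨ iterate-+ x (k * pred p) k ⟨
      iterate f x (k * pred p + k)           ≡⟨ cong (iterate f x) (+-comm (k * pred p) k) ⟩
      iterate f x (k + k * pred p)           ≡⟨ iterate-+ x k (k * pred p) ⟩
      iterate f (iterate f x k) (k * pred p) ≡⟨ iterate-inverse (periodic x) k ⟩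
      x                                      ∎
      where open ≡-Reasoning

module Orbits (A : Perm) where

  private
    n = size A
    σₐ = app A

  index : Carrier A → ℕ
  index x = toℕ (to (enum A) x)

  index<size : ∀ x → index x < n
  index<size x = toℕ<n (to (enum A) x)

  index-injective : ∀ {x y} → index x ≡ index y → x ≡ y
  index-injective = to-injective (enum A) ∘ toℕ-injective

  _≟ₐ_ : (x y : Carrier A) → Dec (x ≡ y)
  x ≟ₐ y = map′ index-injective (cong index) (index x ≟ index y)

  σₐ-injective : Injective _≡_ _≡_ σₐ
  σₐ-injective = to-injective (σ A)

  IsPeriod : Carrier A → Pred ℕ 0ℓ
  IsPeriod x p = 0 < p × iterate σₐ x p ≡ x

  period-exists : ∀ x → ∃ λ p → IsPeriod x p × p ≤ n
  period-exists x with pigeonhole (n<1+n n) (λ i → to (enum A) (iterate σₐ x (toℕ i)))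
  ... | i , j , i<j , same =
    toℕ j ∸ toℕ i ,
    (m<n⇒0<n∸m i<j , iterate-∸-cancel σₐ σₐ-injective (<⇒≤ i<j) (to-injective (enum A) same)) ,
    ≤-trans (m∸n≤m (toℕ j) (toℕ i)) (s≤s⁻¹ (toℕ<n j))

  least-period : ∀ x → ∃ (Least (IsPeriod x))
  least-period x = least (λ p → (0 <? p) ×-dec (iterate σₐ x p ≟ₐ x))
                         (proj₁ (proj₂ (period-exists x)))

  period : Carrier A → ℕ
  period x = proj₁ (least-period x)

  iterate-period : ∀ x → iterate σₐ x (period x) ≡ x
  iterate-period x = proj₂ (proj₁ (proj₂ (least-period x)))

  period-minimal : ∀ x {k} → k < period x → ¬ IsPeriod x k
  period-minimal x = proj₂ (proj₂ (least-period x))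

  instance
    period-nonZero : ∀ {x} → NonZero (period x)
    period-nonZero {x} = >-nonZero (proj₁ (proj₁ (proj₂ (least-period x))))

  period≤size : ∀ x → period x ≤ n
  period≤size x = ≤-trans (Least⇒≤ (proj₂ (least-period x)) (proj₁ (proj₂ (period-exists x))))
                          (proj₂ (proj₂ (period-exists x)))

  private
    iterate-injective-below-period : ∀ x {i j} → i ≤ j → j < period x →
                                     iterate σₐ x i ≡ iterate σₐ x j → i ≡ j
    iterate-injective-below-period x {i} {j} i≤j j<period same =
      ≤-antisym i≤j (m∸n≡0⇒m≤n (n≤0⇒n≡0 (≮⇒≥ λ 0<j∸i →
        period-minimal x (≤-<-trans (m∸n≤m j i) j<period)
                         (0<j∸i , iterate-∸-cancel σₐ σₐ-injective i≤j same))))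

  iterate-≡⇒%-≡ : ∀ x {i j} → iterate σₐ x i ≡ iterate σₐ x j → i % period x ≡ j % period x
  iterate-≡⇒%-≡ x {i} {j} same = [ (λ i≤j → below i≤j (m%n<n j _) same%)
                                  , (λ j≤i → sym (below j≤i (m%n<n i _) (sym same%))) ]′
                                  (≤-total (i % period x) (j % period x))
    where
    below = iterate-injective-below-period x
    same% : iterate σₐ x (i % period x) ≡ iterate σₐ x (j % period x)
    same% = begin
      iterate σₐ x (i % period x) ≡⟨ iterate-%-period σₐ (iterate-period x) i ⟨
      iterate σₐ x i              ≡⟨ same ⟩
      iterate σₐ x j              ≡⟨ iterate-%-period σₐ (iterate-period x) j ⟩
      iterate σₐ x (j % period x) ∎
      where open ≡-Reasoning

  iterate-≡-transfer : ∀ x {i j} → iterate σₐ x i ≡ iterate σₐ x j →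
                       ∀ {S} (g : S → S) {y} → iterate g y (period x) ≡ y →
                       iterate g y i ≡ iterate g y j
  iterate-≡-transfer x {i} {j} same g y-periodic = begin
    iterate g _ i               ≡⟨ iterate-%-period g y-periodic i ⟩
    iterate g _ (i % period x)  ≡⟨ cong (iterate g _) (iterate-≡⇒%-≡ x same) ⟩
    iterate g _ (j % period x)  ≡⟨ iterate-%-period g y-periodic j ⟨
    iterate g _ j               ∎
    where open ≡-Reasoning

  iterate-below-size : ∀ x j → ∃ λ j′ → j′ < n × iterate σₐ x j′ ≡ iterate σₐ x j
  iterate-below-size x j = j % period x , <-≤-trans (m%n<n j (period x)) (period≤size x) ,
                           sym (iterate-%-period σₐ (iterate-period x) j)

  iterate-return : ∀ x j → ∃ λ k → iterate σₐ (iterate σₐ x j) k ≡ x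
  iterate-return x j = j * pred (period x) , iterate-inverse σₐ (iterate-period x) j

  OrbitIndex : Carrier A → Pred ℕ 0ℓ
  OrbitIndex x v = ∃ λ j → j < n × index (iterate σₐ x j) ≡ v

  private
    OrbitIndex-⊆ : ∀ {x y} → (∀ j → ∃ λ k → iterate σₐ y k ≡ iterate σₐ x j) →
                   OrbitIndex x ⊆ OrbitIndex y
    OrbitIndex-⊆ {y = y} x⊆y (j , _ , index≡v) with x⊆y j
    ... | k , same with iterate-below-size y k
    ...   | k′ , k′<n , same′ = k′ , k′<n , trans (cong index (trans same′ same)) index≡v

    least-orbitIndex : ∀ x → ∃ (Least (OrbitIndex x))
    least-orbitIndex x = least (λ v → anyUpTo? (λ j → index (iterate σₐ x j) ≟ v) n)
                               (0 , ≤-<-trans z≤n (index<size x) , refl)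

  minIndex : Carrier A → ℕ
  minIndex x = proj₁ (least-orbitIndex x)

  minIndex-app : ∀ x → minIndex (σₐ x) ≡ minIndex x
  minIndex-app x = Least-unique (OrbitIndex-⊆ (λ j → suc j , refl)) (OrbitIndex-⊆ back)
                                (proj₂ (least-orbitIndex (σₐ x))) (proj₂ (least-orbitIndex x))
    where
    back : ∀ j → ∃ λ k → iterate σₐ (σₐ x) k ≡ iterate σₐ x j
    back j with iterate-return x 1
    ... | k , returns = k + j , trans (iterate-+ σₐ (σₐ x) k j) (cong (λ y → iterate σₐ y j) returns)

  private
    basepointOffset : Carrier A → ℕ
    basepointOffset x = proj₁ (proj₁ (proj₂ (least-orbitIndex x)))

  basepoint : Carrier A → Carrier A
  basepoint x = iterate σₐ x (basepointOffset x)

  index-basepoint : ∀ x → index (basepoint x) ≡ minIndex x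
  index-basepoint x = proj₂ (proj₂ (proj₁ (proj₂ (least-orbitIndex x))))

  basepoint-app : ∀ x → basepoint (σₐ x) ≡ basepoint x
  basepoint-app x = index-injective (trans (index-basepoint (σₐ x))
                                    (trans (minIndex-app x) (sym (index-basepoint x))))

  phase : Carrier A → ℕ
  phase x = proj₁ (iterate-return x (basepointOffset x))

  iterate-phase : ∀ x → iterate σₐ (basepoint x) (phase x) ≡ x
  iterate-phase x = proj₂ (iterate-return x (basepointOffset x))

  cycleLength : Carrier A → ℕ
  cycleLength x = period (basepoint x)

  cycleLength-app : ∀ x → cycleLength (σₐ x) ≡ cycleLength x
  cycleLength-app x = cong period (basepoint-app x)

  cycleLength≤size : ∀ x → cycleLength x ≤ n
  cycleLength≤size x = period≤size (basepoint x)

  2≤cycleLength : ¬ HasFixedPoint A → ∀ x → 2 ≤ cycleLength x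
  2≤cycleLength fixedPointFree x = ≤∧≢⇒< (>-nonZero⁻¹ (cycleLength x)) λ 1≡period →
    fixedPointFree (basepoint x , subst (λ p → iterate σₐ (basepoint x) p ≡ basepoint x) (sym 1≡period)
                                        (iterate-period (basepoint x)))

  iterate-phase-app : ∀ x {S} (g : S → S) {y} → iterate g y (cycleLength x) ≡ y →
                      iterate g y (phase (σₐ x)) ≡ g (iterate g y (phase x))
  iterate-phase-app x g {y} y-periodic =
    trans (iterate-≡-transfer (basepoint x) {phase (σₐ x)} {suc (phase x)} same g y-periodic)
          (iterate-suc g y (phase x))
    where
    same : iterate σₐ (basepoint x) (phase (σₐ x)) ≡ iterate σₐ (basepoint x) (suc (phase x))
    same = begin
      iterate σₐ (basepoint x) (phase (σₐ x))
        ≡⟨ cong (λ b → iterate σₐ b (phase (σₐ x))) (basepoint-app x) ⟨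
      iterate σₐ (basepoint (σₐ x)) (phase (σₐ x))
        ≡⟨ iterate-phase (σₐ x) ⟩
      σₐ x
        ≡⟨ cong σₐ (iterate-phase x) ⟨
      σₐ (iterate σₐ (basepoint x) (phase x))
        ≡⟨ iterate-suc σₐ (basepoint x) (phase x) ⟨
      iterate σₐ (basepoint x) (suc (phase x))
        ∎
      where open ≡-Reasoning

module _ {q : ℕ} .{{_ : NonZero q}} where

  rotate : Fin q → Fin q
  rotate i = suc (toℕ i) mod q

  toℕ-rotate : ∀ i → toℕ (rotate i) ≡ suc (toℕ i) % q
  toℕ-rotate i = toℕ-fromℕ< (m%n<n (suc (toℕ i)) q)

  toℕ-iterate-rotate : ∀ i k → toℕ (iterate rotate i k) ≡ (toℕ i + k) % q
  toℕ-iterate-rotate i zero    = sym (trans (cong (_% q) (+-identityʳ (toℕ i))) (m<n⇒m%n≡m (toℕ<n i)))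
  toℕ-iterate-rotate i (suc k) = begin
    toℕ (iterate rotate (rotate i) k)   ≡⟨ toℕ-iterate-rotate (rotate i) k ⟩
    (toℕ (rotate i) + k) % q            ≡⟨ cong (λ m → (m + k) % q) (toℕ-rotate i) ⟩
    (suc (toℕ i) % q + k) % q           ≡⟨ %-distribˡ-+ (suc (toℕ i) % q) k q ⟩
    (suc (toℕ i) % q % q + k % q) % q   ≡⟨ cong (λ m → (m + k % q) % q) (m%n%n≡m%n (suc (toℕ i)) q) ⟩
    (suc (toℕ i) % q + k % q) % q       ≡⟨ %-distribˡ-+ (suc (toℕ i)) k q ⟨
    (suc (toℕ i) + k) % q               ≡⟨ cong (_% q) (+-suc (toℕ i) k) ⟨
    (toℕ i + suc k) % q                 ∎
    where open ≡-Reasoning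

  iterate-rotate-q : ∀ i → iterate rotate i q ≡ i
  iterate-rotate-q i = toℕ-injective (begin
    toℕ (iterate rotate i q)  ≡⟨ toℕ-iterate-rotate i q ⟩
    (toℕ i + q) % q           ≡⟨ [m+n]%n≡m%n (toℕ i) q ⟩
    toℕ i % q                 ≡⟨ m<n⇒m%n≡m (toℕ<n i) ⟩
    toℕ i                     ∎)
    where open ≡-Reasoning

  rotation : ℕ → Fin q ↔ Fin q
  rotation = iterate-↔ rotate iterate-rotate-q

  rotate-≢ : 1 < q → ∀ i → rotate i ≢ i
  rotate-≢ 1<q i eq = [ 1+i≮q , 1+i≢q ]′ (m≤n⇒m<n∨m≡n (toℕ<n i))
    where
    [1+i]%q≡i : suc (toℕ i) % q ≡ toℕ i
    [1+i]%q≡i = trans (sym (toℕ-rotate i)) (cong toℕ eq)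
    1+i≮q : suc (toℕ i) ≮ q
    1+i≮q 1+i<q = 1+n≢n (trans (sym (m<n⇒m%n≡m 1+i<q)) [1+i]%q≡i)
    1+i≢q : suc (toℕ i) ≢ q
    1+i≢q 1+i≡q = <-irrefl (cong suc (sym i≡0)) (subst (1 <_) (sym 1+i≡q) 1<q)
      where
      i≡0 : toℕ i ≡ 0
      i≡0 = trans (sym [1+i]%q≡i) (trans (cong (_% q) 1+i≡q) (n%n≡0 q))

𝟘 : Perm
𝟘 = record { Carrier = ⊥ ; size = 0 ; enum = ↔-sym 0↔⊥ ; σ = ↔-refl }

_⊕_ : Perm → Perm → Perm
A ⊕ B = record
  { Carrier = Carrier A ⊎ Carrier B
  ; size    = size A + size B
  ; enum    = ↔-trans (enum A ⊎-↔ enum B) (↔-sym +↔⊎)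
  ; σ       = σ A ⊎-↔ σ B
  }

Fixed : ℕ → Perm
Fixed q = record { Carrier = Fin q ; size = q ; enum = ↔-refl ; σ = ↔-refl }

Cycle : (q : ℕ) .{{_ : NonZero q}} → Perm
Cycle q = record { Carrier = Fin q ; size = q ; enum = ↔-refl ; σ = rotation 1 }

⊕-comm : ∀ A B → (A ⊕ B) ≅ (B ⊕ A)
⊕-comm A B = ⊎-comm _ _ , λ { (inj₁ _) → refl ; (inj₂ _) → refl }

HasFixedPoint-reflected : ∀ {A B} → A ≅ B → HasFixedPoint B → HasFixedPoint A
HasFixedPoint-reflected {A} {B} (φ , φ-app) (y , fixed) = x , to-injective φ (begin
  to φ (app A x)  ≡⟨ φ-app x ⟩
  app B (to φ x)  ≡⟨ cong (app B) (strictlyInverseˡ φ y) ⟩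
  app B y         ≡⟨ fixed ⟩
  y               ≡⟨ strictlyInverseˡ φ y ⟨
  to φ x          ∎)
  where
  open ≡-Reasoning
  x = from φ y

record Twist (A : Perm) (U : Pred (Carrier A) 0ℓ) (B C : Perm) : Set where
  field
    fibre     : ∀ a → U a → Carrier B ↔ Carrier C
    fibre-app : ∀ a (u : U a) (u′ : U (app A a)) b →
                to (fibre (app A a) u′) (app B b) ≡ app C (to (fibre a u) b)

open Twist

module _ {A : Perm} {U : Pred (Carrier A) 0ℓ} where

  ≅⇒twist : ∀ {B C} → B ≅ C → Twist A U B C
  ≅⇒twist (φ , φ-app) = record { fibre = λ _ _ → φ ; fibre-app = λ _ _ _ → φ-app }

  twist-refl : ∀ B → Twist A U B B
  twist-refl B = record { fibre = λ _ _ → ↔-refl ; fibre-app = λ _ _ _ _ → refl }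

  twist-sym : ∀ {B C} → Twist A U B C → Twist A U C B
  twist-sym {B} {C} T = record { fibre = λ a u → ↔-sym (fibre T a u) ; fibre-app = app-comm }
    where
    app-comm : ∀ a (u : U a) (u′ : U (app A a)) c →
               from (fibre T (app A a) u′) (app C c) ≡ app B (from (fibre T a u) c)
    app-comm a u u′ c = begin
      from φ′ (app C c)                 ≡⟨ cong (from φ′ ∘ app C) (strictlyInverseˡ φ c) ⟨
      from φ′ (app C (to φ (from φ c))) ≡⟨ cong (from φ′) (fibre-app T a u u′ (from φ c)) ⟨
      from φ′ (to φ′ (app B (from φ c))) ≡⟨ strictlyInverseʳ φ′ _ ⟩
      app B (from φ c)                  ∎
      where
      open ≡-Reasoning
      φ = fibre T a u
      φ′ = fibre T (app A a) u′

  twist-trans : ∀ {B C D} → Twist A U B C → Twist A U C D → Twist A U B D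
  twist-trans T T′ = record
    { fibre     = λ a u → ↔-trans (fibre T a u) (fibre T′ a u)
    ; fibre-app = λ a u u′ b → trans (cong (to (fibre T′ (app A a) u′)) (fibre-app T a u u′ b))
                                      (fibre-app T′ a u u′ _)
    }

  twist-⊗ : ∀ {B C B′ C′} → Twist A U B C → Twist A U B′ C′ → Twist A U (B ⊗ B′) (C ⊗ C′)
  twist-⊗ T T′ = record
    { fibre     = λ a u → fibre T a u ×-↔ fibre T′ a u
    ; fibre-app = λ a u u′ (b , b′) → cong₂ _,_ (fibre-app T a u u′ b) (fibre-app T′ a u u′ b′)
    }

  twist-⊕ : ∀ {B C B′ C′} → Twist A U B C → Twist A U B′ C′ → Twist A U (B ⊕ B′) (C ⊕ C′)
  twist-⊕ T T′ = record
    { fibre     = λ a u → fibre T a u ⊎-↔ fibre T′ a u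
    ; fibre-app = λ { a u u′ (inj₁ b) → cong inj₁ (fibre-app T a u u′ b)
                    ; a u u′ (inj₂ b′) → cong inj₂ (fibre-app T′ a u u′ b′) }
    }

  twist-^ : ∀ {B C} → Twist A U B C → ∀ k → Twist A U (B ^ k) (C ^ k)
  twist-^ T zero    = twist-refl 𝟙
  twist-^ T (suc k) = twist-⊗ T (twist-^ T k)

  twist-∅ : ∀ {B C} → (∀ a → ¬ U a) → Twist A U B C
  twist-∅ empty = record
    { fibre = λ a u → contradiction u (empty a) ; fibre-app = λ a u → contradiction u (empty a) }

  twist-restrict : ∀ {V B C} → V ⊆ U → Twist A U B C → Twist A V B C
  twist-restrict V⊆U T = record
    { fibre = λ a v → fibre T a (V⊆U v) ; fibre-app = λ a v v′ → fibre-app T a (V⊆U v) (V⊆U v′) }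

  twist-cases : ∀ {V B C} → Decidable V →
                (∀ {a} → V a → V (app A a)) → (∀ {a} → V (app A a) → V a) →
                Twist A (U ∩ V) B C → Twist A (U ∩ ∁ V) B C → Twist A U B C
  twist-cases {V} {B} {C} V? V-app V-app⁻ T F = record
    { fibre     = λ a u → choose a u (V? a)
    ; fibre-app = λ a u u′ → choose-app a u u′ (V? a) (V? (app A a))
    }
    where
    choose : ∀ a → U a → Dec (V a) → Carrier B ↔ Carrier C
    choose a u (yes v) = fibre T a (u , v)
    choose a u (no ¬v) = fibre F a (u , ¬v)
    choose-app : ∀ a u u′ (v? : Dec (V a)) (v′? : Dec (V (app A a))) b →
                 to (choose (app A a) u′ v′?) (app B b) ≡ app C (to (choose a u v?) b)
    choose-app a u u′ (yes v) (yes v′) = fibre-app T a (u , v) (u′ , v′)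
    choose-app a u u′ (no ¬v) (no ¬v′) = fibre-app F a (u , ¬v) (u′ , ¬v′)
    choose-app a u u′ (yes v) (no ¬v′) = contradiction (V-app v) ¬v′
    choose-app a u u′ (no ¬v) (yes v′) = contradiction (V-app⁻ v′) ¬v

  twist⇒≅ : ∀ {B C} → Twist A U B C → (∀ a → U a) → (A ⊗ B) ≅ (A ⊗ C)
  twist⇒≅ {B} {C} T all = φ , λ (a , b) → cong (app A a ,_) (fibre-app T a (all a) (all (app A a)) b)
    where
    φ : (Carrier A × Carrier B) ↔ (Carrier A × Carrier C)
    φ = mk↔ₛ′ (λ (a , b) → a , to (fibre T a (all a)) b)
              (λ (a , c) → a , from (fibre T a (all a)) c)
              (λ (a , c) → cong (a ,_) (strictlyInverseˡ (fibre T a (all a)) c))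
              (λ (a , b) → cong (a ,_) (strictlyInverseʳ (fibre T a (all a)) b))

mutual
  X : ℕ → Perm
  X zero    = 𝟘
  X (suc r) = (X r ⊗ Fixed (2 + r)) ⊕ (Y r ⊗ Cycle (2 + r))

  Y : ℕ → Perm
  Y zero    = 𝟙
  Y (suc r) = (Y r ⊗ Fixed (2 + r)) ⊕ (X r ⊗ Cycle (2 + r))

X-fixedPointFree : ∀ r → ¬ HasFixedPoint (X r)
X-fixedPointFree zero    (() , _)
X-fixedPointFree (suc r) (inj₁ (x , _) , fixed) = X-fixedPointFree r (x , ,-injectiveˡ (inj₁-injective fixed))
X-fixedPointFree (suc r) (inj₂ (_ , i) , fixed) = rotate-≢ (s<s z<s) i (,-injectiveʳ (inj₂-injective fixed))

Y-hasFixedPoint : ∀ r → HasFixedPoint (Y r)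
Y-hasFixedPoint zero    = tt , refl
Y-hasFixedPoint (suc r) with Y-hasFixedPoint r
... | y , fixed = inj₁ (y , Fin.zero) , cong (λ y → inj₁ (y , Fin.zero)) fixed

X≇Y : ∀ r → ¬ (X r ≅ Y r)
X≇Y r X≅Y = X-fixedPointFree r (HasFixedPoint-reflected {X r} {Y r} X≅Y (Y-hasFixedPoint r))

module _ {A : Perm} {U : Pred (Carrier A) 0ℓ} where

  twist-X-Y-suc : ∀ {r} → Twist A U (X r) (Y r) → Twist A U (X (suc r)) (Y (suc r))
  twist-X-Y-suc {r} T =
    twist-⊕ (twist-⊗ T (twist-refl (Fixed (2 + r)))) (twist-⊗ (twist-sym T) (twist-refl (Cycle (2 + r))))

  twist-Fixed-Cycle⇒twist-X-Y-suc : ∀ {r} → Twist A U (Fixed (2 + r)) (Cycle (2 + r)) →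
                                    Twist A U (X (suc r)) (Y (suc r))
  twist-Fixed-Cycle⇒twist-X-Y-suc {r} F = twist-trans
    (twist-⊕ (twist-⊗ (twist-refl (X r)) F) (twist-⊗ (twist-refl (Y r)) (twist-sym F)))
    (≅⇒twist (⊕-comm (X r ⊗ Cycle (2 + r)) (Y r ⊗ Fixed (2 + r))))

module _ (A : Perm) where

  open Orbits A

  twist-Fixed-Cycle : ∀ q .{{_ : NonZero q}} → Twist A (λ a → cycleLength a ≡ q) (Fixed q) (Cycle q)
  twist-Fixed-Cycle q = record
    { fibre     = λ a _ → rotation (phase a)
    ; fibre-app = λ a length≡q _ i → iterate-phase-app a rotate
                    (subst (λ p → iterate rotate i p ≡ i) (sym length≡q) (iterate-rotate-q i))
    }

  twist-X-Y : ¬ HasFixedPoint A → ∀ r → Twist A (λ a → cycleLength a < 2 + r) (X r) (Y r)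
  twist-X-Y fixedPointFree zero    = twist-∅ λ a length<2 → <⇒≱ length<2 (2≤cycleLength fixedPointFree a)
  twist-X-Y fixedPointFree (suc r) = twist-cases (λ a → cycleLength a ≟ 2 + r)
    (λ {a} length≡ → trans (cycleLength-app a) length≡)
    (λ {a} length≡ → trans (sym (cycleLength-app a)) length≡)
    (twist-restrict proj₂ (twist-Fixed-Cycle⇒twist-X-Y-suc (twist-Fixed-Cycle (2 + r))))
    (twist-restrict (λ (length<3+r , length≢2+r) → ≤∧≢⇒< (s≤s⁻¹ length<3+r) length≢2+r)
                    (twist-X-Y-suc (twist-X-Y fixedPointFree r)))

lemma8 : (A : Perm) → ¬ HasFixedPoint A →
           (k : ℕ) → 0 < k →
           Σ Perm λ X → Σ Perm λ Y → ¬ (X ≅ Y) × ((A ⊗ (X ^ k)) ≅ (A ⊗ (Y ^ k)))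
lemma8 A fixedPointFree k _ = X (size A) , Y (size A) , X≇Y (size A) ,
  twist⇒≅ (twist-^ (twist-X-Y A fixedPointFree (size A)) k) every-cycle-short
  where
  open Orbits A
  every-cycle-short : ∀ a → cycleLength a < 2 + size A
  every-cycle-short a = s≤s (m≤n⇒m≤1+n (cycleLength≤size a))
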